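{- Let $K$ be a positive, nontrivial semiring containing non-zero elements $a,b$ with $a+b=a$. Then the axiomatization $\mathcal A_{UIND^*}$, consisting of the axioms $\emptyset\vdash x\subseteq^*x$ and $\{x\subseteq^*y,\ y\subseteq^*z\}\vdash x\subseteq^*z$ ($x,y,z$ single variables), is sound and complete for the implication problem for unary marginal distribution inclusion atoms over $K$: for every finite set of variables $D$ and every finite set $\Sigma\cup\{\tau\}$ of atoms of the form $x\subseteq^*y$ with $x,y\in D$, $\Sigma\vdash_{\mathcal A_{UIND^*}}\tau$ iff $\Sigma\models_K\tau$.
   Context: Semirings $(K,+,\times,0,1)$: $(K,+,0)$ commutative monoid, $(K,\times,1)$ monoid, two-sided distributivity, $0\times a=a\times0=0$. Positive: $a+b=0\Rightarrow a=b=0$, $a\times b=0\Rightarrow a=0$ or $b=0$. $K$-teams: $D$ finite set of variables, $A$ finite set of values, $X$ finite set of assignments $s:D\to A$, $\mathbb X:X\to K$. For $x\in D$, $a\in A$: $|\mathbb X_{x=a}|=\sum_{s\in X,\,s(x)=a}\mathbb X(s)$ (empty sum $0$), $X(x)=\{a\in A:|\mathbb X_{x=a}|\ne0\}$. $\mathbb X\models x\subseteq^*y$ iff the multiset $\{\{|\mathbb X_{x=a}|:a\in X(x)\}\}$ is contained in the multiset $\{\{|\mathbb X_{y=a}|:a\in X(y)\}\}$ (each element occurs in the first at most as often as in the second). $\Sigma\models_K\tau$: every $K$-team over $D$ satisfying all atoms of $\Sigma$ satisfies $\tau$. Deduction: $\Sigma\vdash_{\mathcal A}\sigma$ iff there is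 a sequence $\tau_1,\dots,\tau_n=\sigma$ with each $\tau_i\in\Sigma$ or $\tau_i\in\Gamma$ for an instance $\Lambda\vdash\Gamma$ of an axiom of $\mathcal A$ with $\Lambda\subseteq\Sigma\cup\{\tau_1,\dots,\tau_{i-1}\}$. -}

module Defs where

open import Level using (Level; _⊔_)
open import Algebra.Bundles using (Semiring)
open import Data.Nat using (ℕ)
open import Data.Fin using (Fin; _≟_)
open import Data.Vec using (Vec; lookup)
open import Data.List using (List; []; _∷_; _++_)
open import Data.List.Relation.Unary.All using (All)
open import Data.List.Relation.Unary.Unique.Propositional using (Unique)
open import Data.List.Membership.Propositional using (_∈_)
open import Data.Product using (Σ; ∃; ∃-syntax; _×_; _,_; proj₁; proj₂)
open import Data.Sum using (_⊎_)
open import Relation.Nullary using (¬_; yes; no)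
open import Relation.Binary.PropositionalEquality using (_≡_)

module _ {c ℓ : Level} (K : Semiring c ℓ) where
  open Semiring K

  Positive : Set (c ⊔ ℓ)
  Positive = (∀ a b → a + b ≈ 0# → (a ≈ 0# × b ≈ 0#))
           × (∀ a b → a * b ≈ 0# → (a ≈ 0# ⊎ b ≈ 0#))

  Nontrivial : Set ℓ
  Nontrivial = ¬ (0# ≈ 1#)

  HasAbsorbingPair : Set (c ⊔ ℓ)
  HasAbsorbingPair = ∃[ a ] ∃[ b ] (¬ (a ≈ 0#) × ¬ (b ≈ 0#) × (a + b ≈ a))

-- K-teams. Variables D = Fin n, values A = Fin m.
-- An assignment s : D → A is a vector (s(x) = lookup s x).

Assignment : ℕ → ℕ → Set
Assignment n m = Vec (Fin m) n

record Team {c ℓ : Level} (K : Semiring c ℓ) (n m : ℕ) : Set c where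
  open Semiring K
  field
    X      : List (Assignment n m)
    unique : Unique X
    𝕏      : Assignment n m → Carrier  -- the weight function (only used on X)

module _ {c ℓ : Level} (K : Semiring c ℓ) {n m : ℕ} where
  open Semiring K

  margin-list : (Assignment n m → Carrier) → List (Assignment n m) → Fin n → Fin m → Carrier
  margin-list w [] x a = 0#
  margin-list w (s ∷ xs) x a with lookup s x ≟ a
  ... | yes _ = w s + margin-list w xs x a
  ... | no  _ = margin-list w xs x a

  margin : Team K n m → Fin n → Fin m → Carrier
  margin T = margin-list (Team.𝕏 T) (Team.X T)

  -- Multiset inclusion of {{ f a : a ∈ A, f a ≠ 0 }} in {{ g b : b ∈ A, g b ≠ 0 }}:
  -- an injective map from the non-zero positions of f to the non-zero positions
  -- of g preserving the value.
  SubMultiset : (Fin m → Carrier) → (Fin m → Carrier) → Set ℓ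
  SubMultiset f g =
    Σ ((a : Fin m) → ¬ (f a ≈ 0#) → Fin m) λ ι →
        (∀ a (p : ¬ (f a ≈ 0#)) → ¬ (g (ι a p) ≈ 0#))
      × (∀ a (p : ¬ (f a ≈ 0#)) → f a ≈ g (ι a p))
      × (∀ a (p : ¬ (f a ≈ 0#)) b (q : ¬ (f b ≈ 0#)) → ι a p ≡ ι b q → a ≡ b)

Atom : ℕ → Set
Atom n = Fin n × Fin n

_⊆*_ : {n : ℕ} → Fin n → Fin n → Atom n
x ⊆* y = x , y

module _ {c ℓ : Level} (K : Semiring c ℓ) {n m : ℕ} where
  _⊨atom_ : Team K n m → Atom n → Set ℓ
  T ⊨atom (x , y) = SubMultiset K {n} {m} (margin K T x) (margin K T y)

_⊨[_]_ : {c ℓ : Level} {n : ℕ} → List (Atom n) → (K : Semiring c ℓ) → Atom n → Set (c ⊔ ℓ)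
_⊨[_]_ {n = n} Σs K τ =
  (m : ℕ) (T : Team K n m) → All (_⊨atom_ K {n} {m} T) Σs → _⊨atom_ K {n} {m} T τ

data Justified {n : ℕ} (Σs prev : List (Atom n)) : Atom n → Set where
  hyp   : ∀ {τ} → τ ∈ Σs → Justified Σs prev τ
  refl* : ∀ x → Justified Σs prev (x ⊆* x)
  trans* : ∀ {x y z} → (x ⊆* y) ∈ (Σs ++ prev) → (y ⊆* z) ∈ (Σs ++ prev)
         → Justified Σs prev (x ⊆* z)

-- A deduction sequence τ₁,…,τₖ, stored in reverse order (τₖ ∷ … ∷ τ₁ ∷ [])
data Deduction {n : ℕ} (Σs : List (Atom n)) : List (Atom n) → Set where
  []  : Deduction Σs []
  _∷_ : ∀ {τ prev} → Justified Σs prev τ → Deduction Σs prev → Deduction Σs (τ ∷ prev)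

_⊢UIND*_ : {n : ℕ} → List (Atom n) → Atom n → Set
Σs ⊢UIND* σ = ∃[ prev ] Deduction Σs (σ ∷ prev)

module Submission where

open import Defs
open import Level using (Level)
open import Algebra.Bundles using (Semiring)
open import Data.Bool using (Bool; true; false; T; _∨_; _∧_)
open import Data.Bool.Properties using (T-∨; T-∧; T-≡)
open import Data.Empty using (⊥-elim)
open import Data.Fin using (Fin; zero; suc; _≟_)
open import Data.Fin.Properties using (0≢1+n)
open import Data.List using (List; []; _∷_; _++_)
open import Data.List.Membership.Propositional using (_∈_)
open import Data.List.Membership.Propositional.Properties using (∈-++⁺ʳ)
open import Data.List.Relation.Binary.Subset.Propositional using (_⊆_)
open import Data.List.Relation.Binary.Subset.Propositional.Properties using (xs⊆xs++ys; ++⁺ʳ)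
open import Data.List.Relation.Unary.All as All using (All; []; _∷_)
open import Data.List.Relation.Unary.All.Properties using (++⁺)
open import Data.List.Relation.Unary.Any using (here; there)
open import Data.List.Relation.Unary.AllPairs using ([]; _∷_)
open import Data.Nat using (ℕ)
open import Data.Product using (_×_; _,_)
open import Data.Sum using (_⊎_; inj₁; inj₂; map₂)
open import Data.Vec using (lookup; tabulate)
open import Data.Vec.Properties using (lookup∘tabulate)
open import Function using (_∘_; _⇔_; mk⇔; Equivalence)
open import Relation.Nullary using (¬_; yes; no)
open import Relation.Nullary.Decidable using (⌊_⌋; T?; toWitness; fromWitness)
open import Relation.Binary.PropositionalEquality as ≡ using (_≡_; _≢_)
import Relation.Binary.Reasoning.Setoid as SetoidReasoning

open Equivalence using (to; from)

-- Soundness holds because multiset inclusion is reflexive and transitive.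
-- For completeness, let U be the set of variables reachable from x along the
-- edges of Σ. If y ∈ U, chaining the edges of a path derives x ⊆* y. Otherwise
-- take the team of two assignments, s₀ constantly 0 with weight a and s₁ the
-- indicator of U with weight b: every variable in U has marginal {{a, b}},
-- every other one {{a + b}} = {{a}}, so Σ holds (edges never leave U) while
-- {{a, b}} ⊈ {{a}} refutes x ⊆* y.

module _ {n : ℕ} where

  private variable
    Σs prev prev′ : List (Atom n)
    τ             : Atom n

  data Derivable (Σs : List (Atom n)) : Atom n → Set where
    hyp    : ∀ {τ} → τ ∈ Σs → Derivable Σs τ
    refl*  : ∀ x → Derivable Σs (x ⊆* x)
    trans* : ∀ {x y z} → Derivable Σs (x ⊆* y) → Derivable Σs (y ⊆* z) → Derivable Σs (x ⊆* z)

  Derivable-weaken : {σ : Atom n} → Derivable Σs τ → Derivable (σ ∷ Σs) τ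
  Derivable-weaken (hyp τ∈Σs)     = hyp (there τ∈Σs)
  Derivable-weaken (refl* x)      = refl* x
  Derivable-weaken (trans* d₁ d₂) = trans* (Derivable-weaken d₁) (Derivable-weaken d₂)

  Justified-mono : prev ⊆ prev′ → Justified Σs prev τ → Justified Σs prev′ τ
  Justified-mono           prev⊆ (hyp τ∈Σs)     = hyp τ∈Σs
  Justified-mono           prev⊆ (refl* x)      = refl* x
  Justified-mono {Σs = Σs} prev⊆ (trans* m₁ m₂) =
    trans* (++⁺ʳ Σs prev⊆ m₁) (++⁺ʳ Σs prev⊆ m₂)

  Deduction-++ : {p q : List (Atom n)} → Deduction Σs p → Deduction Σs q → Deduction Σs (p ++ q)
  Deduction-++         []      E = E
  Deduction-++ {q = q} (j ∷ D) E = Justified-mono (xs⊆xs++ys _ q) j ∷ Deduction-++ D E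

  Derivable⇒⊢ : Derivable Σs τ → Σs ⊢UIND* τ
  Derivable⇒⊢ (hyp τ∈Σs) = [] , hyp τ∈Σs ∷ []
  Derivable⇒⊢ (refl* x)  = [] , refl* x ∷ []
  Derivable⇒⊢ {Σs} (trans* {x} {y} {z} d₁ d₂) with Derivable⇒⊢ d₁ | Derivable⇒⊢ d₂
  ... | p , D | q , E =
    ((x ⊆* y) ∷ p) ++ ((y ⊆* z) ∷ q) ,
    trans* (∈-++⁺ʳ Σs (here ≡.refl)) (∈-++⁺ʳ Σs (∈-++⁺ʳ ((x ⊆* y) ∷ p) (here ≡.refl)))
      ∷ Deduction-++ D E

  -- Paths through the edges of Σs, added one edge at a time; a shortest path
  -- uses every edge at most once.
  reaches : List (Atom n) → Fin n → Fin n → Bool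
  reaches []             x z = ⌊ x ≟ z ⌋
  reaches ((u , v) ∷ Σs) x z = reaches Σs x z ∨ (reaches Σs x u ∧ reaches Σs v z)

  T-reaches-∷ : ∀ {u v} Σs {x z} → T (reaches ((u , v) ∷ Σs) x z)
              ⇔ (T (reaches Σs x z) ⊎ (T (reaches Σs x u) × T (reaches Σs v z)))
  T-reaches-∷ {u} {v} Σs {x} {z} = mk⇔
    (map₂ (to (T-∧ {reaches Σs x u})) ∘ to (T-∨ {reaches Σs x z}))
    (from (T-∨ {reaches Σs x z}) ∘ map₂ (from T-∧))

  reaches-refl : ∀ Σs x → T (reaches Σs x x)
  reaches-refl []      x = fromWitness ≡.refl
  reaches-refl (_ ∷ Σs) x = from (T-reaches-∷ Σs) (inj₁ (reaches-refl Σs x))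

  reaches-∈ : ∀ Σs {u v} → (u ⊆* v) ∈ Σs → T (reaches Σs u v)
  reaches-∈ ((u , v) ∷ Σs) (here ≡.refl) =
    from (T-reaches-∷ Σs) (inj₂ (reaches-refl Σs u , reaches-refl Σs v))
  reaches-∈ (_ ∷ Σs) (there uv∈Σs) = from (T-reaches-∷ Σs) (inj₁ (reaches-∈ Σs uv∈Σs))

  reaches-trans : ∀ Σs {x y z} → T (reaches Σs x y) → T (reaches Σs y z) → T (reaches Σs x z)
  reaches-trans [] {x} {y} {z} r s with toWitness {a? = x ≟ y} r | toWitness {a? = y ≟ z} s
  ... | ≡.refl | ≡.refl = r
  reaches-trans ((u , v) ∷ Σs) r s =
    from (T-reaches-∷ Σs) (compose (to (T-reaches-∷ Σs) r) (to (T-reaches-∷ Σs) s))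
    where
    compose : ∀ {x y z}
            → T (reaches Σs x y) ⊎ (T (reaches Σs x u) × T (reaches Σs v y))
            → T (reaches Σs y z) ⊎ (T (reaches Σs y u) × T (reaches Σs v z))
            → T (reaches Σs x z) ⊎ (T (reaches Σs x u) × T (reaches Σs v z))
    compose (inj₁ xy)        (inj₁ yz)        = inj₁ (reaches-trans Σs xy yz)
    compose (inj₁ xy)        (inj₂ (yu , vz)) = inj₂ (reaches-trans Σs xy yu , vz)
    compose (inj₂ (xu , vy)) (inj₁ yz)        = inj₂ (xu , reaches-trans Σs vy yz)
    compose (inj₂ (xu , _))  (inj₂ (_ , vz))  = inj₂ (xu , vz)

  reaches⇒Derivable : ∀ Σs {x z} → T (reaches Σs x z) → Derivable Σs (x ⊆* z)
  reaches⇒Derivable [] {x} {z} r with toWitness {a? = x ≟ z} r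
  ... | ≡.refl = refl* x
  reaches⇒Derivable ((u , v) ∷ Σs) r with to (T-reaches-∷ Σs) r
  ... | inj₁ xz        = Derivable-weaken (reaches⇒Derivable Σs xz)
  ... | inj₂ (xu , vz) =
    trans* (Derivable-weaken (reaches⇒Derivable Σs xu))
           (trans* (hyp (here ≡.refl)) (Derivable-weaken (reaches⇒Derivable Σs vz)))

module _ {c ℓ : Level} (K : Semiring c ℓ) {n m : ℕ} where
  open Semiring K

  private variable
    f f′ g g′ h : Fin m → Carrier

  SubMultiset-pointwise : (∀ i → f i ≈ 0# ⊎ f i ≈ g i) → SubMultiset K {n} f g
  SubMultiset-pointwise {f = f} {g = g} f≼g = (λ i _ → i) , g≉0 , f≈g , λ _ _ _ _ i≡j → i≡j
    where
    g≉0 : ∀ i → ¬ f i ≈ 0# → ¬ g i ≈ 0#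
    g≉0 i fi≉0 gi≈0 with f≼g i
    ... | inj₁ fi≈0  = fi≉0 fi≈0
    ... | inj₂ fi≈gi = fi≉0 (trans fi≈gi gi≈0)
    f≈g : ∀ i → ¬ f i ≈ 0# → f i ≈ g i
    f≈g i fi≉0 with f≼g i
    ... | inj₁ fi≈0  = ⊥-elim (fi≉0 fi≈0)
    ... | inj₂ fi≈gi = fi≈gi

  SubMultiset-refl : (f : Fin m → Carrier) → SubMultiset K {n} f f
  SubMultiset-refl f = SubMultiset-pointwise (λ _ → inj₂ refl)

  SubMultiset-trans : SubMultiset K {n} f g → SubMultiset K {n} g h → SubMultiset K {n} f h
  SubMultiset-trans (ι , ι≉0 , f≈gι , ι-inj) (κ , κ≉0 , g≈hκ , κ-inj) =
    (λ i p → κ (ι i p) (ι≉0 i p)) ,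
    (λ i p → κ≉0 (ι i p) (ι≉0 i p)) ,
    (λ i p → trans (f≈gι i p) (g≈hκ (ι i p) (ι≉0 i p))) ,
    (λ i p j q κι≡κι → ι-inj i p j q (κ-inj (ι i p) (ι≉0 i p) (ι j q) (ι≉0 j q) κι≡κι))

  SubMultiset-resp-≈ : (∀ i → f i ≈ f′ i) → (∀ i → g i ≈ g′ i)
                     → SubMultiset K {n} f′ g′ → SubMultiset K {n} f g
  SubMultiset-resp-≈ {f = f} {f′ = f′} f≈f′ g≈g′ (ι , ι≉0 , f′≈g′ι , ι-inj) =
    (λ i p → ι i (nonzero i p)) ,
    (λ i p gι≈0 → ι≉0 i (nonzero i p) (trans (sym (g≈g′ _)) gι≈0)) ,
    (λ i p → trans (f≈f′ i) (trans (f′≈g′ι i (nonzero i p)) (sym (g≈g′ _)))) ,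
    (λ i p j q → ι-inj i (nonzero i p) j (nonzero j q))
    where
    nonzero : ∀ i → ¬ f i ≈ 0# → ¬ f′ i ≈ 0#
    nonzero i p f′i≈0 = p (trans (f≈f′ i) f′i≈0)

  Deduction-sound : (𝕋 : Team K n m) {Σs p : List (Atom n)}
                  → All (_⊨atom_ K 𝕋) Σs → Deduction Σs p → All (_⊨atom_ K 𝕋) p
  Deduction-sound 𝕋 ⊨Σs [] = []
  Deduction-sound 𝕋 {Σs} {_ ∷ prev} ⊨Σs (j ∷ D) = ⊨j j ∷ ⊨prev
    where
    ⊨prev : All (_⊨atom_ K 𝕋) prev
    ⊨prev = Deduction-sound 𝕋 ⊨Σs D
    ⊨j : ∀ {τ} → Justified Σs prev τ → _⊨atom_ K 𝕋 τ
    ⊨j (hyp τ∈Σs)                     = All.lookup ⊨Σs τ∈Σs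
    ⊨j (refl* x)                      = SubMultiset-refl (margin K 𝕋 x)
    ⊨j (trans* {y = y} {z = z} m₁ m₂) =
      SubMultiset-trans {g = margin K 𝕋 y} {h = margin K 𝕋 z}
        (All.lookup (++⁺ ⊨Σs ⊨prev) m₁) (All.lookup (++⁺ ⊨Σs ⊨prev) m₂)

  margin-list-hit : (w : Assignment n m → Carrier) (s : Assignment n m) (xs : List (Assignment n m))
                  {v : Fin n} {i : Fin m} → lookup s v ≡ i
                  → margin-list K w (s ∷ xs) v i ≡ w s + margin-list K w xs v i
  margin-list-hit w s xs {v} {i} sv≡i with lookup s v ≟ i
  ... | yes _    = ≡.refl
  ... | no sv≢i = ⊥-elim (sv≢i sv≡i)

  margin-list-miss : (w : Assignment n m → Carrier) (s : Assignment n m) (xs : List (Assignment n m))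
                   {v : Fin n} {i j : Fin m} → lookup s v ≡ j → j ≢ i
                   → margin-list K w (s ∷ xs) v i ≡ margin-list K w xs v i
  margin-list-miss w s xs {v} {i} sv≡j j≢i with lookup s v ≟ i
  ... | yes sv≡i = ⊥-elim (j≢i (≡.trans (≡.sym sv≡j) sv≡i))
  ... | no _     = ≡.refl

module TwoAssignmentTeam {c ℓ : Level} (K : Semiring c ℓ) {n : ℕ}
  (U : Fin n → Bool) (x : Fin n) (x∈U : T (U x)) (a b : Semiring.Carrier K) where
  open Semiring K hiding (zero)
  open SetoidReasoning setoid

  bit : Bool → Fin 2
  bit false = zero
  bit true  = suc zero

  s₀ s₁ : Assignment n 2
  s₀ = tabulate (λ _ → zero)
  s₁ = tabulate (bit ∘ U)

  lookup-s₀ : ∀ v → lookup s₀ v ≡ zero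
  lookup-s₀ = lookup∘tabulate (λ _ → zero)

  lookup-s₁ : ∀ v → lookup s₁ v ≡ bit (U v)
  lookup-s₁ = lookup∘tabulate (bit ∘ U)

  lookup-s₁-x : lookup s₁ x ≡ suc zero
  lookup-s₁-x = ≡.trans (lookup-s₁ x) (≡.cong bit (to T-≡ x∈U))

  profile : Bool → Fin 2 → Carrier
  profile _     zero    = a
  profile true  (suc _) = b
  profile false (suc _) = 0#

  weight : Assignment n 2 → Carrier
  weight s = profile true (lookup s x)

  weight-s₀ : weight s₀ ≡ a
  weight-s₀ = ≡.cong (profile true) (lookup-s₀ x)

  weight-s₁ : weight s₁ ≡ b
  weight-s₁ = ≡.cong (profile true) lookup-s₁-x

  s₀≢s₁ : s₀ ≢ s₁
  s₀≢s₁ s₀≡s₁ = 0≢1+n (≡.trans (≡.sym (lookup-s₀ x))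
                        (≡.trans (≡.cong (λ s → lookup s x) s₀≡s₁) lookup-s₁-x))

  team : Team K n 2
  team = record { X = s₀ ∷ s₁ ∷ [] ; unique = (s₀≢s₁ ∷ []) ∷ [] ∷ [] ; 𝕏 = weight }

  mass : List (Assignment n 2) → Fin n → Fin 2 → Carrier
  mass = margin-list K weight

  margin-profile : a + b ≈ a → ∀ v i → margin K team v i ≈ profile (U v) i
  margin-profile a+b≈a v i with U v | lookup-s₁ v | i
  ... | true | s₁v≡1 | zero = begin
    mass (s₀ ∷ s₁ ∷ []) v zero         ≡⟨ margin-list-hit K weight s₀ _ (lookup-s₀ v) ⟩
    weight s₀ + mass (s₁ ∷ []) v zero  ≡⟨ ≡.cong (weight s₀ +_)
                                           (margin-list-miss K weight s₁ [] s₁v≡1 (0≢1+n ∘ ≡.sym)) ⟩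
    weight s₀ + 0#                     ≈⟨ +-identityʳ _ ⟩
    weight s₀                          ≡⟨ weight-s₀ ⟩
    a                                  ∎
  ... | true | s₁v≡1 | suc zero = begin
    mass (s₀ ∷ s₁ ∷ []) v (suc zero)   ≡⟨ margin-list-miss K weight s₀ _ (lookup-s₀ v) 0≢1+n ⟩
    mass (s₁ ∷ []) v (suc zero)        ≡⟨ margin-list-hit K weight s₁ [] s₁v≡1 ⟩
    weight s₁ + 0#                     ≈⟨ +-identityʳ _ ⟩
    weight s₁                          ≡⟨ weight-s₁ ⟩
    b                                  ∎
  ... | false | s₁v≡0 | zero = begin
    mass (s₀ ∷ s₁ ∷ []) v zero         ≡⟨ margin-list-hit K weight s₀ _ (lookup-s₀ v) ⟩
    weight s₀ + mass (s₁ ∷ []) v zero  ≡⟨ ≡.cong (weight s₀ +_)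
                                           (margin-list-hit K weight s₁ [] s₁v≡0) ⟩
    weight s₀ + (weight s₁ + 0#)       ≈⟨ +-congˡ (+-identityʳ _) ⟩
    weight s₀ + weight s₁              ≡⟨ ≡.cong₂ _+_ weight-s₀ weight-s₁ ⟩
    a + b                              ≈⟨ a+b≈a ⟩
    a                                  ∎
  ... | false | s₁v≡0 | suc zero = begin
    mass (s₀ ∷ s₁ ∷ []) v (suc zero)   ≡⟨ margin-list-miss K weight s₀ _ (lookup-s₀ v) 0≢1+n ⟩
    mass (s₁ ∷ []) v (suc zero)        ≡⟨ margin-list-miss K weight s₁ [] s₁v≡0 0≢1+n ⟩
    0#                                 ∎

  profile-⊆ : ∀ p q → (T p → T q) → SubMultiset K {n} (profile p) (profile q)
  profile-⊆ p q p⇒q = SubMultiset-pointwise K {n} (pointwise p q p⇒q)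
    where
    pointwise : ∀ p q → (T p → T q) → ∀ i → profile p i ≈ 0# ⊎ profile p i ≈ profile q i
    pointwise _     _     _   zero    = inj₂ refl
    pointwise false _     _   (suc _) = inj₁ refl
    pointwise true  true  _   (suc _) = inj₂ refl
    pointwise true  false p⇒q (suc _) = ⊥-elim (p⇒q _)

  profile-⊈ : ¬ a ≈ 0# → ¬ b ≈ 0# → ∀ p q → T p → ¬ T q
            → ¬ SubMultiset K {n} (profile p) (profile q)
  profile-⊈ a≉0 b≉0 true  true  _ ¬q _ = ¬q _
  profile-⊈ a≉0 b≉0 true  false _ _  (ι , ι≉0 , _ , ι-inj) =
    0≢1+n (ι-inj zero a≉0 (suc zero) b≉0
             (≡.trans (nonzero⇒zero (ι≉0 zero a≉0))
                      (≡.sym (nonzero⇒zero (ι≉0 (suc zero) b≉0)))))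
    where
    nonzero⇒zero : ∀ {i} → ¬ profile false i ≈ 0# → i ≡ zero
    nonzero⇒zero {zero}  _     = ≡.refl
    nonzero⇒zero {suc _} ¬0≈0 = ⊥-elim (¬0≈0 refl)

  team-⊨ : a + b ≈ a → (Σs : List (Atom n))
         → (∀ {u v} → (u ⊆* v) ∈ Σs → T (U u) → T (U v))
         → All (_⊨atom_ K team) Σs
  team-⊨ a+b≈a Σs U-closed = All.tabulate λ {(u , v)} uv∈Σs →
    SubMultiset-resp-≈ K {n} (margin-profile a+b≈a u) (margin-profile a+b≈a v)
      (profile-⊆ (U u) (U v) (U-closed uv∈Σs))

  team-⊭ : a + b ≈ a → ¬ a ≈ 0# → ¬ b ≈ 0#
         → ∀ y → ¬ T (U y) → ¬ _⊨atom_ K team (x ⊆* y)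
  team-⊭ a+b≈a a≉0 b≉0 y y∉U =
    profile-⊈ a≉0 b≉0 (U x) (U y) x∈U y∉U
      ∘ SubMultiset-resp-≈ K {n} (sym ∘ margin-profile a+b≈a x) (sym ∘ margin-profile a+b≈a y)

theorem5 : {c ℓ : Level} (K : Semiring c ℓ) →
    Positive K → Nontrivial K → HasAbsorbingPair K →
    (n : ℕ) (Σs : List (Atom n)) (τ : Atom n) →
    ((Σs ⊢UIND* τ → Σs ⊨[ K ] τ) × (Σs ⊨[ K ] τ → Σs ⊢UIND* τ))
theorem5 K _ _ (a , b , a≉0 , b≉0 , a+b≈a) n Σs (x , y) = sound , complete
  where
  sound : Σs ⊢UIND* (x ⊆* y) → Σs ⊨[ K ] (x ⊆* y)
  sound (_ , D) m 𝕋 ⊨Σs = All.head (Deduction-sound K 𝕋 ⊨Σs D)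

  complete : Σs ⊨[ K ] (x ⊆* y) → Σs ⊢UIND* (x ⊆* y)
  complete ⊨xy with T? (reaches Σs x y)
  ... | yes x⇝y = Derivable⇒⊢ (reaches⇒Derivable Σs x⇝y)
  ... | no x⇝̸y =
    ⊥-elim (team-⊭ a+b≈a a≉0 b≉0 y x⇝̸y (⊨xy 2 team (team-⊨ a+b≈a Σs reach-closed)))
    where
    open TwoAssignmentTeam K (reaches Σs x) x (reaches-refl Σs x) a b
    reach-closed : ∀ {u v} → (u ⊆* v) ∈ Σs → T (reaches Σs x u) → T (reaches Σs x v)
    reach-closed uv∈Σs x⇝u = reaches-trans Σs x⇝u (reaches-∈ Σs uv∈Σs)
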